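{- Let $G_1$ and $G_2$ be graphs on the node set $\{1,\dots,n\}$, $n\ge 2$, with adjacency matrices $A_1,A_2$. If $G_1$ and $G_2$ are $\mathfrak{w}$-equivalent, then $G_1$ and $G_2$ are cospectral, i.e. $A_1$ and $A_2$ have the same eigenvalues with the same multiplicities.
   Context: Graphs are finite undirected graphs without multiple edges; loops are permitted (a loop at $i$ gives adjacency entry $A_{ii}=1$). For a graph $G$ with adjacency matrix $A$ and a node $i$, the $\mathfrak{w}$-label $\mathfrak{w}_G(i)$ is the matrix with rows indexed by the nodes $j$ and columns indexed by $l\in\{0,1,2,\dots\}$ whose $(j,l)$ entry is $(A^l)_{ij}$, the number of walks of length $l$ between $i$ and $j$. Two matrices $Q_1,Q_2$ with the same row index set are permutation-equal, written $Q_1\simeq Q_2$, if there is a permutation matrix $P$ with $PQ_1=Q_2$ (i.e. $Q_2$ arises from $Q_1$ by permuting rows). $G_1$ and $G_2$ are $\mathfrak{w}$-equivalent if there is a bijection $\pi:V_1\to V_2$ with $\mathfrak{w}_{G_1}(i)\simeq\mathfrak{w}_{G_2}(\pi(i))$ for every node $i$ of $G_1$. -}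

module Defs where

open import Data.Nat using (ℕ; zero; suc)
import Data.Nat
open import Data.Bool using (Bool; true; false)
open import Data.Fin using (Fin; zero; suc; toℕ; punchIn)
open import Data.Fin.Permutation using (Permutation′; _⟨$⟩ʳ_)
open import Data.Integer as ℤ using (ℤ; +_)
open import Relation.Nullary using (yes; no)
open import Data.Fin using (_≟_)
open import Data.Product using (Σ; ∃; _×_)
open import Relation.Binary.PropositionalEquality using (_≡_)

-- A graph on node set Fin n (nodes 1..n): symmetric 0/1 adjacency matrix,
-- loops permitted (diagonal entries may be 1), no multiple edges.
record Graph (n : ℕ) : Set where
  field
    adj : Fin n → Fin n → Bool
    sym : ∀ i j → adj i j ≡ adj j i

open Graph public

Matrix : Set → ℕ → Set
Matrix A n = Fin n → Fin n → A

b2ℕ : Bool → ℕ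
b2ℕ true  = 1
b2ℕ false = 0

adjMat : ∀ {n} → Graph n → Matrix ℕ n
adjMat G i j = b2ℕ (adj G i j)

sumℕ : ∀ {n} → (Fin n → ℕ) → ℕ
sumℕ {zero}  f = 0
sumℕ {suc n} f = f zero Data.Nat.+ sumℕ (λ k → f (suc k))

sumℤ : ∀ {n} → (Fin n → ℤ) → ℤ
sumℤ {zero}  f = + 0
sumℤ {suc n} f = f zero ℤ.+ sumℤ (λ k → f (suc k))

_⊗_ : ∀ {n} → Matrix ℕ n → Matrix ℕ n → Matrix ℕ n
(M ⊗ N) i j = sumℕ (λ k → M i k Data.Nat.* N k j)

idMat : ∀ {n} → Matrix ℕ n
idMat i j with i ≟ j
... | yes _ = 1
... | no  _ = 0

matPow : ∀ {n} → Matrix ℕ n → ℕ → Matrix ℕ n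
matPow M zero    = idMat
matPow M (suc l) = M ⊗ matPow M l

-- the w-label of node i: rows indexed by nodes j, columns by l ∈ ℕ,
-- entry (j , l) = (A^l)_{ij} = number of walks of length l between i and j
wLabel : ∀ {n} → Graph n → Fin n → (Fin n → ℕ → ℕ)
wLabel G i j l = matPow (adjMat G) l i j

_≃ᵖ_ : ∀ {n} → (Fin n → ℕ → ℕ) → (Fin n → ℕ → ℕ) → Set
_≃ᵖ_ {n} Q₁ Q₂ = Σ (Permutation′ n) λ σ → ∀ j l → Q₂ j l ≡ Q₁ (σ ⟨$⟩ʳ j) l

wEquivalent : ∀ {n} → Graph n → Graph n → Set
wEquivalent {n} G₁ G₂ = Σ (Permutation′ n) λ π → ∀ i → wLabel G₁ i ≃ᵖ wLabel G₂ (π ⟨$⟩ʳ i)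

sgn : ℕ → ℤ
sgn zero    = + 1
sgn (suc k) = ℤ.- sgn k

det : ∀ {n} → Matrix ℤ n → ℤ
det {zero}  M = + 1
det {suc n} M = sumℤ (λ j → sgn (toℕ j) ℤ.* (M zero j ℤ.* det (λ r c → M (suc r) (punchIn j c))))

charPoly : ∀ {n} → Matrix ℕ n → ℤ → ℤ
charPoly M x = det (λ i j → x ℤ.* (+ idMat i j) ℤ.- (+ M i j))

-- cospectral: A₁ and A₂ have the same characteristic polynomial (equivalently,
-- same eigenvalues with multiplicities). Both are monic of degree n with integer
-- coefficients, so equality as polynomials ⇔ equality at every integer x.
Cospectral : ∀ {n} → Graph n → Graph n → Set
Cospectral G₁ G₂ = ∀ (x : ℤ) → charPoly (adjMat G₁) x ≡ charPoly (adjMat G₂) x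

-- Column 0 of a w-label counts walks of length 0, so it is the indicator of the node; hence the row
-- permutation relating the labels of i and π i sends row π i to row i, and (A₂ˡ)_{π i, π i} = (A₁ˡ)ᵢᵢ.
-- Summing over the bijection π, A₁ and A₂ have the same power traces tr Aˡ.
-- For a symmetric integer matrix A with det (x I − A) = Σ χₖ xᵏ, the cofactor identity
-- cof(x) · (x I − A) = det (x I − A) · I compared coefficientwise, traced against the powers of A, and
-- combined with Jacobi's formula tr cof(x) = d/dx det (x I − A), yields Newton's identities
-- (k − n) χₖ = Σ_{t<n} χ_{k+1+t} tr A^{t+1}.  Since χₖ = 0 for k > n and χₙ = 1, downward induction on k
-- shows that the power traces determine every χₖ.  Identities between polynomials in x are passed to
-- their coefficients because an integer polynomial vanishing at every nonzero integer is zero.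

module Submission where

open import Defs hiding (sym)
open import Data.Nat as ℕ using (ℕ; zero; suc; _≤_; _<_; s≤s; z≤n)
import Data.Nat.Properties as ℕ
open import Data.Fin using (Fin; zero; suc; toℕ; punchIn; punchOut; _≟_)
import Data.Fin.Properties as Fin
open import Data.Fin.Permutation using (_⟨$⟩ʳ_)
open import Data.Integer as ℤ using (ℤ; +_; _+_; _*_; -_; _-_; ∣_∣)
import Data.Integer.Properties as ℤ
open import Data.Integer.Tactic.RingSolver using (solve-∀)
open import Data.Vec.Functional using (updateAt)
open import Data.Vec.Functional.Properties
  using (updateAt-updates; updateAt-minimal; updateAt-commutes; updateAt-id-local; map-updateAt-local)
open import Data.Product using (_,_)
open import Data.Sum using (inj₁; inj₂)
open import Data.Empty using (⊥-elim)
open import Function using (_∘_; const)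
open import Relation.Nullary using (yes; no)
open import Relation.Binary.PropositionalEquality
open ≡-Reasoning

open import Algebra.Properties.Semiring.Sum ℤ.+-*-semiring
  using (sum; sum-cong-≗; ∑-distrib-+; ∑-comm; sum-remove; *-distribˡ-sum)
import Algebra.Properties.CommutativeMonoid.Sum ℕ.+-0-commutativeMonoid as ℕΣ
open import Algebra.Properties.AbelianGroup ℤ.+-0-abelianGroup using (inverseˡ-unique)

-- Finite sums

sumℤ≡sum : ∀ {n} (f : Fin n → ℤ) → sumℤ f ≡ sum f
sumℤ≡sum {zero}  f = refl
sumℤ≡sum {suc n} f = cong (_+_ (f zero)) (sumℤ≡sum (f ∘ suc))

sumℤ-cong : ∀ {n} {f g : Fin n → ℤ} → (∀ i → f i ≡ g i) → sumℤ f ≡ sumℤ g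
sumℤ-cong {zero}  f≗g = refl
sumℤ-cong {suc n} f≗g = cong₂ _+_ (f≗g zero) (sumℤ-cong (f≗g ∘ suc))

sumℤ-+ : ∀ {n} (f g : Fin n → ℤ) → sumℤ (λ i → f i + g i) ≡ sumℤ f + sumℤ g
sumℤ-+ f g = begin
  sumℤ (λ i → f i + g i) ≡⟨ sumℤ≡sum (λ i → f i + g i) ⟩
  sum (λ i → f i + g i)  ≡⟨ ∑-distrib-+ f g ⟩
  sum f + sum g          ≡⟨ cong₂ _+_ (sumℤ≡sum f) (sumℤ≡sum g) ⟨
  sumℤ f + sumℤ g        ∎

*-distribˡ-sumℤ : ∀ {n} a (f : Fin n → ℤ) → a * sumℤ f ≡ sumℤ (λ i → a * f i)
*-distribˡ-sumℤ a f = begin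
  a * sumℤ f             ≡⟨ cong (a *_) (sumℤ≡sum f) ⟩
  a * sum f              ≡⟨ *-distribˡ-sum a f ⟩
  sum (λ i → a * f i)    ≡⟨ sumℤ≡sum (λ i → a * f i) ⟨
  sumℤ (λ i → a * f i)   ∎

sumℤ-comm : ∀ {m n} (f : Fin m → Fin n → ℤ) →
            sumℤ (λ i → sumℤ (f i)) ≡ sumℤ (λ j → sumℤ (λ i → f i j))
sumℤ-comm f = begin
  sumℤ (λ i → sumℤ (f i))              ≡⟨ sumℤ≡sum (λ i → sumℤ (f i)) ⟩
  sum (λ i → sumℤ (f i))               ≡⟨ sum-cong-≗ (sumℤ≡sum ∘ f) ⟩
  sum (λ i → sum (f i))                ≡⟨ ∑-comm f ⟩
  sum (λ j → sum (λ i → f i j))        ≡⟨ sum-cong-≗ (λ j → sumℤ≡sum (λ i → f i j)) ⟨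
  sum (λ j → sumℤ (λ i → f i j))       ≡⟨ sumℤ≡sum (λ j → sumℤ (λ i → f i j)) ⟨
  sumℤ (λ j → sumℤ (λ i → f i j))      ∎

sumℤ-remove : ∀ {n} (f : Fin (suc n) → ℤ) i → sumℤ f ≡ f i + sumℤ (f ∘ punchIn i)
sumℤ-remove f i = begin
  sumℤ f                        ≡⟨ sumℤ≡sum f ⟩
  sum f                         ≡⟨ sum-remove f ⟩
  f i + sum (f ∘ punchIn i)     ≡⟨ cong (_+_ (f i)) (sumℤ≡sum (f ∘ punchIn i)) ⟨
  f i + sumℤ (f ∘ punchIn i)    ∎

sumℤ-zero : ∀ {n} (f : Fin n → ℤ) → (∀ i → f i ≡ + 0) → sumℤ f ≡ + 0
sumℤ-zero {zero}  f f≡0 = refl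
sumℤ-zero {suc n} f f≡0 = cong₂ _+_ (f≡0 zero) (sumℤ-zero (f ∘ suc) (f≡0 ∘ suc))

sumℤ-neg : ∀ {n} (f : Fin n → ℤ) → sumℤ (λ i → - f i) ≡ - sumℤ f
sumℤ-neg {zero}  f = refl
sumℤ-neg {suc n} f = begin
  - f zero + sumℤ (λ i → - f (suc i)) ≡⟨ cong (_+_ (- f zero)) (sumℤ-neg (f ∘ suc)) ⟩
  - f zero + - sumℤ (f ∘ suc)         ≡⟨ ℤ.neg-distrib-+ (f zero) _ ⟨
  - sumℤ f                            ∎

sumℤ-const : ∀ n a → sumℤ {n} (const a) ≡ + n * a
sumℤ-const zero    a = sym (ℤ.*-zeroˡ a)
sumℤ-const (suc n) a = trans (cong (_+_ a) (sumℤ-const n a)) (lemma (+ n) a)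
  where
  lemma : ∀ m a → a + m * a ≡ (+ 1 + m) * a
  lemma = solve-∀

sumℤ-linear : ∀ {n} a (f g h : Fin n → ℤ) → (∀ j → h j ≡ a * f j + g j) → sumℤ h ≡ a * sumℤ f + sumℤ g
sumℤ-linear a f g h h≗af+g = begin
  sumℤ h                          ≡⟨ sumℤ-cong h≗af+g ⟩
  sumℤ (λ j → a * f j + g j)      ≡⟨ sumℤ-+ (λ j → a * f j) g ⟩
  sumℤ (λ j → a * f j) + sumℤ g   ≡⟨ cong (_+ sumℤ g) (*-distribˡ-sumℤ a f) ⟨
  a * sumℤ f + sumℤ g             ∎

sumℤ-linear₂ : ∀ {n} s a b (f g : Fin n → ℤ) →
               sumℤ (λ i → s * (a * f i + b * g i)) ≡ s * (a * sumℤ f + b * sumℤ g)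
sumℤ-linear₂ s a b f g = begin
  sumℤ (λ i → s * (a * f i + b * g i))           ≡⟨ *-distribˡ-sumℤ s (λ i → a * f i + b * g i) ⟨
  s * sumℤ (λ i → a * f i + b * g i)             ≡⟨ cong (s *_) (sumℤ-+ (λ i → a * f i) (λ i → b * g i)) ⟩
  s * (sumℤ (λ i → a * f i) + sumℤ (λ i → b * g i))
    ≡⟨ cong₂ (λ p q → s * (p + q)) (*-distribˡ-sumℤ a f) (*-distribˡ-sumℤ b g) ⟨
  s * (a * sumℤ f + b * sumℤ g)                  ∎

x≡-x⇒x≡0 : ∀ x → x ≡ - x → x ≡ + 0
x≡-x⇒x≡0 x x≡-x with ℤ.i*j≡0⇒i≡0∨j≡0 (+ 2) {x} 2x≡0
  where
  lemma : ∀ x → + 2 * x ≡ x + x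
  lemma = solve-∀
  2x≡0 : + 2 * x ≡ + 0
  2x≡0 = trans (lemma x) (trans (cong (_+_ x) x≡-x) (ℤ.+-inverseʳ x))
... | inj₂ x≡0 = x≡0

sumℤ²-antisymmetric : ∀ {n} (H : Fin n → Fin n → ℤ) → (∀ j k → H j k ≡ - H k j) →
                      sumℤ (λ j → sumℤ (H j)) ≡ + 0
sumℤ²-antisymmetric H anti = x≡-x⇒x≡0 _ (begin
  sumℤ (λ j → sumℤ (H j))             ≡⟨ sumℤ-comm H ⟩
  sumℤ (λ k → sumℤ (λ j → H j k))     ≡⟨ sumℤ-cong (λ k → sumℤ-cong (λ j → anti j k)) ⟩
  sumℤ (λ k → sumℤ (λ j → - H k j))   ≡⟨ sumℤ-cong (λ k → sumℤ-neg (H k)) ⟩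
  sumℤ (λ k → - sumℤ (H k))           ≡⟨ sumℤ-neg (λ k → sumℤ (H k)) ⟩
  - sumℤ (λ j → sumℤ (H j))           ∎)

-- Determinants

δ : ∀ {n} → Fin n → Fin n → ℤ
δ i j = + idMat i j

idMat-diag : ∀ {n} (i : Fin n) → idMat i i ≡ 1
idMat-diag i with i ≟ i
... | yes _  = refl
... | no i≢i = ⊥-elim (i≢i refl)

idMat-off : ∀ {n} {i j : Fin n} → i ≢ j → idMat i j ≡ 0
idMat-off {i = i} {j} i≢j with i ≟ j
... | yes i≡j = ⊥-elim (i≢j i≡j)
... | no _    = refl

idMat-sym : ∀ {n} (i j : Fin n) → idMat i j ≡ idMat j i
idMat-sym i j with i ≟ j
... | yes refl = sym (idMat-diag i)
... | no i≢j   = sym (idMat-off (i≢j ∘ sym))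

idMat≡1⇒≡ : ∀ {n} {i j : Fin n} → idMat i j ≡ 1 → i ≡ j
idMat≡1⇒≡ {i = i} {j} eq with i ≟ j
... | yes i≡j = i≡j
... | no _ with () ← eq

sumℤ-δʳ : ∀ {n} (f : Fin n → ℤ) k → sumℤ (λ j → f j * δ j k) ≡ f k
sumℤ-δʳ {suc n} f k = begin
  sumℤ (λ j → f j * δ j k)                                  ≡⟨ sumℤ-remove (λ j → f j * δ j k) k ⟩
  f k * δ k k + sumℤ (λ c → f (punchIn k c) * δ (punchIn k c) k)
    ≡⟨ cong₂ (λ d s → f k * + d + s) (idMat-diag k) (sumℤ-zero _ off-diagonal) ⟩
  f k * + 1 + + 0                                           ≡⟨ lemma (f k) ⟩
  f k                                                       ∎
  where
  off-diagonal : ∀ c → f (punchIn k c) * δ (punchIn k c) k ≡ + 0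
  off-diagonal c = begin
    f (punchIn k c) * δ (punchIn k c) k ≡⟨ cong (λ d → f (punchIn k c) * + d) (idMat-off (Fin.punchInᵢ≢i k c)) ⟩
    f (punchIn k c) * + 0                ≡⟨ ℤ.*-zeroʳ (f (punchIn k c)) ⟩
    + 0                                  ∎
  lemma : ∀ a → a * + 1 + + 0 ≡ a
  lemma = solve-∀

sumℤ-δˡ : ∀ {n} (f : Fin n → ℤ) k → sumℤ (λ j → δ k j * f j) ≡ f k
sumℤ-δˡ f k = trans (sumℤ-cong λ j → trans (ℤ.*-comm (δ k j) (f j)) (cong (λ d → f j * + d) (idMat-sym k j)))
                    (sumℤ-δʳ f k)

infixl 6 _[_]≔_

_[_]≔_ : ∀ {n} {A : Set} → (Fin n → A) → Fin n → A → Fin n → A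
M [ i ]≔ v = updateAt M i (const v)

minor : ∀ {n} → Matrix ℤ (suc n) → Fin (suc n) → Matrix ℤ n
minor M j r c = M (suc r) (punchIn j c)

minor-[]≔ : ∀ {n} (M : Matrix ℤ (suc n)) i (v : Fin (suc n) → ℤ) j r c →
            minor (M [ suc i ]≔ v) j r c ≡ (minor M j [ i ]≔ v ∘ punchIn j) r c
minor-[]≔ M i v j r c = cong-app (map-updateAt-local {f = _∘ punchIn j} (M ∘ suc) i refl r) c

sign : ∀ {n} → Fin n → ℤ
sign j = sgn (toℕ j)

det-cong : ∀ {n} {M N : Matrix ℤ n} → (∀ i j → M i j ≡ N i j) → det M ≡ det N
det-cong {zero}  M≗N = refl
det-cong {suc n} M≗N = sumℤ-cong λ j →
  cong₂ (λ a d → sign j * (a * d)) (M≗N zero j) (det-cong λ r c → M≗N (suc r) (punchIn j c))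

[]≔-cong : ∀ {n} (M : Matrix ℤ n) i {u v : Fin n → ℤ} → (∀ c → u c ≡ v c) →
           ∀ r c → (M [ i ]≔ u) r c ≡ (M [ i ]≔ v) r c
[]≔-cong M i {u} {v} u≗v r c with r ≟ i
... | yes refl = begin
  (M [ r ]≔ u) r c ≡⟨ cong-app (updateAt-updates r M) c ⟩
  u c              ≡⟨ u≗v c ⟩
  v c              ≡⟨ cong-app (updateAt-updates r M) c ⟨
  (M [ r ]≔ v) r c ∎
... | no r≢i = cong-app (trans (updateAt-minimal r i M r≢i) (sym (updateAt-minimal r i M r≢i))) c

det-[]≔-cong : ∀ {n} (M : Matrix ℤ n) i {u v : Fin n → ℤ} → (∀ c → u c ≡ v c) →
               det (M [ i ]≔ u) ≡ det (M [ i ]≔ v)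
det-[]≔-cong M i u≗v = det-cong ([]≔-cong M i u≗v)

det-minor-[]≔ : ∀ {n} (M : Matrix ℤ (suc n)) i v j →
                det (minor (M [ suc i ]≔ v) j) ≡ det (minor M j [ i ]≔ v ∘ punchIn j)
det-minor-[]≔ M i v j = det-cong (minor-[]≔ M i v j)

det-linear : ∀ {n} (M : Matrix ℤ n) i a (u w : Fin n → ℤ) →
             det (M [ i ]≔ (λ c → a * u c + w c)) ≡ a * det (M [ i ]≔ u) + det (M [ i ]≔ w)
det-linear {suc n} M zero a u w = sumℤ-linear a _ _ _ λ j → lemma (sign j) a (u j) (w j) (det (minor M j))
  where
  lemma : ∀ s a u w d → s * ((a * u + w) * d) ≡ a * (s * (u * d)) + s * (w * d)
  lemma = solve-∀
det-linear {suc n} M (suc i) a u w = sumℤ-linear a _ _ _ λ j → begin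
  sign j * (M zero j * det (minor (M [ suc i ]≔ (λ c → a * u c + w c)) j))
    ≡⟨ cong (λ d → sign j * (M zero j * d))
            (trans (det-minor-[]≔ M i _ j) (det-linear (minor M j) i a (u ∘ punchIn j) (w ∘ punchIn j))) ⟩
  sign j * (M zero j * (a * U j + W j))
    ≡⟨ lemma (sign j) (M zero j) a (U j) (W j) ⟩
  a * (sign j * (M zero j * U j)) + sign j * (M zero j * W j)
    ≡⟨ cong₂ (λ d e → a * (sign j * (M zero j * d)) + sign j * (M zero j * e))
             (det-minor-[]≔ M i u j) (det-minor-[]≔ M i w j) ⟨
  a * (sign j * (M zero j * det (minor (M [ suc i ]≔ u) j))) + sign j * (M zero j * det (minor (M [ suc i ]≔ w) j))
    ∎
  where
  U W : Fin (suc n) → ℤ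
  U j = det (minor M j [ i ]≔ u ∘ punchIn j)
  W j = det (minor M j [ i ]≔ w ∘ punchIn j)
  lemma : ∀ s m a u w → s * (m * (a * u + w)) ≡ a * (s * (m * u)) + s * (m * w)
  lemma = solve-∀

det-additive : ∀ {n} (M : Matrix ℤ n) i (u w : Fin n → ℤ) →
               det (M [ i ]≔ (λ c → u c + w c)) ≡ det (M [ i ]≔ u) + det (M [ i ]≔ w)
det-additive M i u w = begin
  det (M [ i ]≔ (λ c → u c + w c))         ≡⟨ det-[]≔-cong M i (λ c → cong (_+ w c) (ℤ.*-identityˡ (u c))) ⟨
  det (M [ i ]≔ (λ c → + 1 * u c + w c))   ≡⟨ det-linear M i (+ 1) u w ⟩
  + 1 * det (M [ i ]≔ u) + det (M [ i ]≔ w) ≡⟨ cong (_+ det (M [ i ]≔ w)) (ℤ.*-identityˡ (det (M [ i ]≔ u))) ⟩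
  det (M [ i ]≔ u) + det (M [ i ]≔ w)       ∎

det-zero-row : ∀ {n} (M : Matrix ℤ n) i → det (M [ i ]≔ const (+ 0)) ≡ + 0
det-zero-row M i = trans (det-linear M i (- + 1) (const (+ 0)) (const (+ 0))) (lemma (det (M [ i ]≔ const (+ 0))))
  where
  lemma : ∀ d → - + 1 * d + d ≡ + 0
  lemma = solve-∀

det-sum-row : ∀ {n m} (M : Matrix ℤ n) i (a : Fin m → ℤ) (v : Fin m → Fin n → ℤ) →
              det (M [ i ]≔ (λ c → sumℤ (λ j → a j * v j c))) ≡ sumℤ (λ j → a j * det (M [ i ]≔ v j))
det-sum-row {m = zero}  M i a v = det-zero-row M i
det-sum-row {m = suc m} M i a v = begin
  det (M [ i ]≔ (λ c → a zero * v zero c + sumℤ (λ j → a (suc j) * v (suc j) c)))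
    ≡⟨ det-linear M i (a zero) (v zero) _ ⟩
  a zero * det (M [ i ]≔ v zero) + det (M [ i ]≔ (λ c → sumℤ (λ j → a (suc j) * v (suc j) c)))
    ≡⟨ cong (_+_ (a zero * det (M [ i ]≔ v zero))) (det-sum-row M i (a ∘ suc) (v ∘ suc)) ⟩
  a zero * det (M [ i ]≔ v zero) + sumℤ (λ j → a (suc j) * det (M [ i ]≔ v (suc j))) ∎

punchIn-punchOut-comm : ∀ {n} {j k : Fin (suc (suc n))} (j≢k : j ≢ k) (k≢j : k ≢ j) c →
                        punchIn j (punchIn (punchOut j≢k) c) ≡ punchIn k (punchIn (punchOut k≢j) c)
punchIn-punchOut-comm {j = zero}  {zero}  j≢k k≢j c = ⊥-elim (j≢k refl)
punchIn-punchOut-comm {j = zero}  {suc k} j≢k k≢j c = refl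
punchIn-punchOut-comm {j = suc j} {zero}  j≢k k≢j c = refl
punchIn-punchOut-comm {suc n} {suc j} {suc k} j≢k k≢j zero    = refl
punchIn-punchOut-comm {suc n} {suc j} {suc k} j≢k k≢j (suc c) =
  cong suc (punchIn-punchOut-comm (j≢k ∘ cong suc) (k≢j ∘ cong suc) c)

sign-punchOut : ∀ {n} {j k : Fin (suc (suc n))} (j≢k : j ≢ k) (k≢j : k ≢ j) →
                sign j * sign (punchOut j≢k) ≡ - (sign k * sign (punchOut k≢j))
sign-punchOut {j = zero}  {zero}  j≢k k≢j = ⊥-elim (j≢k refl)
sign-punchOut {j = zero}  {suc k} j≢k k≢j = lemma (sign k)
  where
  lemma : ∀ s → + 1 * s ≡ - ((- s) * + 1)
  lemma = solve-∀
sign-punchOut {j = suc j} {zero}  j≢k k≢j = lemma (sign j)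
  where
  lemma : ∀ s → (- s) * + 1 ≡ - (+ 1 * s)
  lemma = solve-∀
sign-punchOut {zero}  {suc zero} {suc zero} j≢k k≢j = ⊥-elim (j≢k refl)
sign-punchOut {suc n} {suc j}    {suc k}    j≢k k≢j = begin
  (- sign j) * (- sign (punchOut j≢k′))     ≡⟨ lemma (sign j) (sign (punchOut j≢k′)) ⟨
  sign j * sign (punchOut j≢k′)             ≡⟨ sign-punchOut j≢k′ k≢j′ ⟩
  - (sign k * sign (punchOut k≢j′))         ≡⟨ cong -_ (lemma (sign k) (sign (punchOut k≢j′))) ⟩
  - ((- sign k) * (- sign (punchOut k≢j′))) ∎
  where
  j≢k′ = j≢k ∘ cong suc
  k≢j′ = k≢j ∘ cong suc
  lemma : ∀ a b → a * b ≡ (- a) * (- b)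
  lemma = solve-∀

module _ {n} (M : Matrix ℤ (suc (suc n))) where

  private
    D : Fin (suc (suc n)) → Fin (suc n) → ℤ
    D j c = det (minor (minor M j) c)

  -- The term of the expansion of det M along rows 0 and 1 that uses columns j and k.
  expansion₀₁ : Fin (suc (suc n)) → Fin (suc (suc n)) → ℤ
  expansion₀₁ j k with j ≟ k
  ... | yes _  = + 0
  ... | no j≢k = sign j * sign (punchOut j≢k) * (M zero j * M (suc zero) k) * D j (punchOut j≢k)

  private
    expansion₀₁-diag : ∀ j → expansion₀₁ j j ≡ + 0
    expansion₀₁-diag j with j ≟ j
    ... | yes _  = refl
    ... | no j≢j = ⊥-elim (j≢j refl)

    expansion₀₁-punchIn : ∀ j c →
      expansion₀₁ j (punchIn j c) ≡ sign j * sign c * (M zero j * M (suc zero) (punchIn j c)) * D j c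
    expansion₀₁-punchIn j c with j ≟ punchIn j c
    ... | yes j≡ = ⊥-elim (Fin.punchInᵢ≢i j c (sym j≡))
    ... | no j≢  = cong (λ c′ → sign j * sign c′ * (M zero j * M (suc zero) (punchIn j c)) * D j c′)
                        (trans (Fin.punchOut-cong j refl) (Fin.punchOut-punchIn j))

    row-expansion₀₁ : ∀ j → sign j * (M zero j * det (minor M j)) ≡ sumℤ (expansion₀₁ j)
    row-expansion₀₁ j = begin
      sign j * (M zero j * sumℤ (λ c → sign c * (M (suc zero) (punchIn j c) * D j c)))
        ≡⟨ lemma (sign j) (M zero j) (det (minor M j)) ⟩
      sign j * M zero j * sumℤ (λ c → sign c * (M (suc zero) (punchIn j c) * D j c))
        ≡⟨ *-distribˡ-sumℤ (sign j * M zero j) (λ c → sign c * (M (suc zero) (punchIn j c) * D j c)) ⟩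
      sumℤ (λ c → sign j * M zero j * (sign c * (M (suc zero) (punchIn j c) * D j c)))
        ≡⟨ sumℤ-cong (λ c → trans (lemma′ (sign j) (M zero j) (sign c) (M (suc zero) (punchIn j c)) (D j c))
                                  (sym (expansion₀₁-punchIn j c))) ⟩
      sumℤ (expansion₀₁ j ∘ punchIn j)
        ≡⟨ ℤ.+-identityˡ (sumℤ (expansion₀₁ j ∘ punchIn j)) ⟨
      + 0 + sumℤ (expansion₀₁ j ∘ punchIn j)
        ≡⟨ cong (_+ sumℤ (expansion₀₁ j ∘ punchIn j)) (expansion₀₁-diag j) ⟨
      expansion₀₁ j j + sumℤ (expansion₀₁ j ∘ punchIn j)
        ≡⟨ sumℤ-remove (expansion₀₁ j) j ⟨
      sumℤ (expansion₀₁ j) ∎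
      where
      lemma : ∀ a b c → a * (b * c) ≡ a * b * c
      lemma = solve-∀
      lemma′ : ∀ a b c d e → a * b * (c * (d * e)) ≡ a * c * (b * d) * e
      lemma′ = solve-∀

  det-expansion₀₁ : det M ≡ sumℤ (λ j → sumℤ (expansion₀₁ j))
  det-expansion₀₁ = sumℤ-cong row-expansion₀₁

  expansion₀₁-antisymmetric : (∀ c → M zero c ≡ M (suc zero) c) → ∀ j k → expansion₀₁ j k ≡ - expansion₀₁ k j
  expansion₀₁-antisymmetric row₀≡row₁ j k with j ≟ k | k ≟ j
  ... | yes _   | yes _   = refl
  ... | yes j≡k | no k≢j  = ⊥-elim (k≢j (sym j≡k))
  ... | no j≢k  | yes k≡j = ⊥-elim (j≢k (sym k≡j))
  ... | no j≢k  | no k≢j  = begin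
    sign j * sign (punchOut j≢k) * (M zero j * M (suc zero) k) * D j (punchOut j≢k)
      ≡⟨ cong₂ (λ s d → s * (M zero j * M (suc zero) k) * d) (sign-punchOut j≢k k≢j)
               (det-cong λ r c → cong (M (suc (suc r))) (punchIn-punchOut-comm j≢k k≢j c)) ⟩
    - s′ * (M zero j * M (suc zero) k) * D k (punchOut k≢j)
      ≡⟨ cong₂ (λ a b → - s′ * (a * b) * D k (punchOut k≢j)) (row₀≡row₁ j) (sym (row₀≡row₁ k)) ⟩
    - s′ * (M (suc zero) j * M zero k) * D k (punchOut k≢j)
      ≡⟨ lemma s′ (M (suc zero) j) (M zero k) (D k (punchOut k≢j)) ⟩
    - (s′ * (M zero k * M (suc zero) j) * D k (punchOut k≢j)) ∎
    where
    s′ = sign k * sign (punchOut k≢j)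
    lemma : ∀ s a b d → - s * (a * b) * d ≡ - (s * (b * a) * d)
    lemma = solve-∀

det-rows01-equal : ∀ {n} (M : Matrix ℤ (suc (suc n))) → (∀ c → M zero c ≡ M (suc zero) c) → det M ≡ + 0
det-rows01-equal M row₀≡row₁ =
  trans (det-expansion₀₁ M) (sumℤ²-antisymmetric (expansion₀₁ M) (expansion₀₁-antisymmetric M row₀≡row₁))

Alternating : ℕ → Set
Alternating n = ∀ (M : Matrix ℤ n) {i k} → i ≢ k → (∀ c → M i c ≡ M k c) → det M ≡ + 0

swapRows : ∀ {n} → Matrix ℤ n → Fin n → Fin n → Matrix ℤ n
swapRows M i k = M [ i ]≔ M k [ k ]≔ M i

module _ {n} (M : Matrix ℤ n) {i k : Fin n} (i≢k : i ≢ k) where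

  withRows : (Fin n → ℤ) → (Fin n → ℤ) → Matrix ℤ n
  withRows a b = M [ i ]≔ a [ k ]≔ b

  withRows-original : ∀ r → withRows (M i) (M k) r ≡ M r
  withRows-original r with r ≟ k
  ... | yes refl = updateAt-updates r (M [ i ]≔ M i)
  ... | no r≢k   = trans (updateAt-minimal r k _ r≢k) (updateAt-id-local i M refl r)

  withRows-equal : ∀ a c → withRows a a i c ≡ withRows a a k c
  withRows-equal a c = begin
    withRows a a i c   ≡⟨ cong-app (updateAt-minimal i k _ i≢k) c ⟩
    (M [ i ]≔ a) i c   ≡⟨ cong-app (updateAt-updates i M) c ⟩
    a c                ≡⟨ cong-app (updateAt-updates k (M [ i ]≔ a)) c ⟨
    withRows a a k c   ∎

  det-withRows-additiveˡ : ∀ u v b → det (withRows (λ c → u c + v c) b) ≡ det (withRows u b) + det (withRows v b)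
  det-withRows-additiveˡ u v b = begin
    det (withRows (λ c → u c + v c) b)                    ≡⟨ commute (λ c → u c + v c) ⟩
    det (M [ k ]≔ b [ i ]≔ (λ c → u c + v c))             ≡⟨ det-additive (M [ k ]≔ b) i u v ⟩
    det (M [ k ]≔ b [ i ]≔ u) + det (M [ k ]≔ b [ i ]≔ v) ≡⟨ cong₂ _+_ (commute u) (commute v) ⟨
    det (withRows u b) + det (withRows v b)               ∎
    where
    commute : ∀ a → det (withRows a b) ≡ det (M [ k ]≔ b [ i ]≔ a)
    commute a = det-cong λ r c → cong-app (updateAt-commutes k i (i≢k ∘ sym) M r) c

  det-withRows-bilinear : ∀ u v → let X = λ a b → det (withRows a b) in
    X (λ c → u c + v c) (λ c → u c + v c) ≡ (X u u + X v u) + (X u v + X v v)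
  det-withRows-bilinear u v = begin
    det (withRows (λ c → u c + v c) (λ c → u c + v c))
      ≡⟨ det-additive (M [ i ]≔ (λ c → u c + v c)) k u v ⟩
    det (withRows (λ c → u c + v c) u) + det (withRows (λ c → u c + v c) v)
      ≡⟨ cong₂ _+_ (det-withRows-additiveˡ u v u) (det-withRows-additiveˡ u v v) ⟩
    (det (withRows u u) + det (withRows v u)) + (det (withRows u v) + det (withRows v v)) ∎

alternating⇒det-swapRows : ∀ {n} → Alternating n → (M : Matrix ℤ n) {i k : Fin n} → i ≢ k →
                           det (swapRows M i k) ≡ - det M
alternating⇒det-swapRows alt M {i} {k} i≢k = begin
  X v u   ≡⟨ inverseˡ-unique (X v u) (X u v) Xvu+Xuv≡0 ⟩
  - X u v ≡⟨ cong -_ (det-cong λ r c → cong-app (withRows-original M i≢k r) c) ⟩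
  - det M ∎
  where
  u = M i
  v = M k
  X = λ a b → det (withRows M i≢k a b)
  X-diag : ∀ a → X a a ≡ + 0
  X-diag a = alt (withRows M i≢k a a) i≢k (withRows-equal M i≢k a)
  Xvu+Xuv≡0 : X v u + X u v ≡ + 0
  Xvu+Xuv≡0 = begin
    X v u + X u v                           ≡⟨ lemma (X v u) (X u v) ⟩
    (+ 0 + X v u) + (X u v + + 0)           ≡⟨ cong₂ (λ p q → (p + X v u) + (X u v + q)) (X-diag u) (X-diag v) ⟨
    (X u u + X v u) + (X u v + X v v)       ≡⟨ det-withRows-bilinear M i≢k u v ⟨
    X (λ c → u c + v c) (λ c → u c + v c)   ≡⟨ X-diag (λ c → u c + v c) ⟩
    + 0                                     ∎
    where
    lemma : ∀ a b → a + b ≡ (+ 0 + a) + (b + + 0)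
    lemma = solve-∀

det-rows0k-equal : ∀ {n} → Alternating n → (M : Matrix ℤ (suc n)) (k : Fin n) → (∀ c → M zero c ≡ M (suc k) c) →
                   det M ≡ + 0
det-rows0k-equal         alt M zero    row₀≡row₁ = det-rows01-equal M row₀≡row₁
det-rows0k-equal {suc n} alt M (suc k) row₀≡rowₖ = begin
  det M       ≡⟨ ℤ.neg-involutive (det M) ⟨
  - - det M   ≡⟨ cong -_ det-M′ ⟨
  - det M′    ≡⟨ cong -_ (det-rows01-equal M′ row₀≡rowₖ) ⟩
  - + 0       ∎
  where
  -- Swapping row 1 with the copy of row 0 negates every minor along row 0 and makes rows 0 and 1 equal.
  M′ : Matrix ℤ (suc (suc n))
  M′ = swapRows M (suc zero) (suc (suc k))

  minor-M′ : ∀ j r c → minor M′ j r c ≡ swapRows (minor M j) zero (suc k) r c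
  minor-M′ j zero    c = refl
  minor-M′ j (suc r) c = cong-app (map-updateAt-local {f = _∘ punchIn j} (λ r → M (suc (suc r))) k refl r) c

  det-M′ : det M′ ≡ - det M
  det-M′ = begin
    sumℤ (λ j → sign j * (M zero j * det (minor M′ j)))
      ≡⟨ sumℤ-cong (λ j → cong (λ d → sign j * (M zero j * d))
                              (trans (det-cong (minor-M′ j))
                                     (alternating⇒det-swapRows alt (minor M j) {zero} {suc k} λ ()))) ⟩
    sumℤ (λ j → sign j * (M zero j * - det (minor M j)))
      ≡⟨ sumℤ-cong (λ j → lemma (sign j) (M zero j) (det (minor M j))) ⟩
    sumℤ (λ j → - (sign j * (M zero j * det (minor M j))))
      ≡⟨ sumℤ-neg (λ j → sign j * (M zero j * det (minor M j))) ⟩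
    - det M ∎
    where
    lemma : ∀ s a d → s * (a * - d) ≡ - (s * (a * d))
    lemma = solve-∀

det-alternating : ∀ {n} → Alternating n
det-alternating {suc n} M {zero}  {zero}  0≢0 _     = ⊥-elim (0≢0 refl)
det-alternating {suc n} M {zero}  {suc k} _   rows≡ = det-rows0k-equal det-alternating M k rows≡
det-alternating {suc n} M {suc i} {zero}  _   rows≡ = det-rows0k-equal det-alternating M i (sym ∘ rows≡)
det-alternating {suc n} M {suc i} {suc k} i≢k rows≡ = sumℤ-zero _ λ j → begin
  sign j * (M zero j * det (minor M j))
    ≡⟨ cong (λ d → sign j * (M zero j * d)) (det-alternating (minor M j) (i≢k ∘ cong suc) (rows≡ ∘ punchIn j)) ⟩
  sign j * (M zero j * + 0) ≡⟨ lemma (sign j) (M zero j) ⟩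
  + 0                       ∎
  where
  lemma : ∀ s a → s * (a * + 0) ≡ + 0
  lemma = solve-∀

det-row-copy : ∀ {n} (M : Matrix ℤ n) i k → det (M [ i ]≔ M k) ≡ δ i k * det M
det-row-copy M i k with i ≟ k
... | yes refl = begin
  det (M [ i ]≔ M i) ≡⟨ det-cong (λ r c → cong-app (updateAt-id-local i M refl r) c) ⟩
  det M              ≡⟨ ℤ.*-identityˡ (det M) ⟨
  + 1 * det M        ∎
... | no i≢k = begin
  det (M [ i ]≔ M k) ≡⟨ det-alternating (M [ i ]≔ M k) i≢k row-i≡row-k ⟩
  + 0                ≡⟨ ℤ.*-zeroˡ (det M) ⟨
  + 0 * det M        ∎
  where
  row-i≡row-k : ∀ c → (M [ i ]≔ M k) i c ≡ (M [ i ]≔ M k) k c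
  row-i≡row-k c = trans (cong-app (updateAt-updates i M) c) (sym (cong-app (updateAt-minimal k i M (i≢k ∘ sym)) c))

cofactor-expansion : ∀ {n} (M : Matrix ℤ n) i k → sumℤ (λ j → M k j * det (M [ i ]≔ δ j)) ≡ δ i k * det M
cofactor-expansion M i k = begin
  sumℤ (λ j → M k j * det (M [ i ]≔ δ j))             ≡⟨ det-sum-row M i (M k) δ ⟨
  det (M [ i ]≔ (λ c → sumℤ (λ j → M k j * δ j c)))   ≡⟨ det-[]≔-cong M i (sumℤ-δʳ (M k)) ⟩
  det (M [ i ]≔ M k)                                 ≡⟨ det-row-copy M i k ⟩
  δ i k * det M                                      ∎

-- Polynomials as coefficient sequences

eval : ℕ → (ℕ → ℤ) → ℤ → ℤ
eval zero    f x = + 0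
eval (suc d) f x = f zero + x * eval d (f ∘ suc) x

shift : (ℕ → ℤ) → ℕ → ℤ
shift f zero    = + 0
shift f (suc m) = f m

shift-cong : ∀ {f g : ℕ → ℤ} → (∀ m → f m ≡ g m) → ∀ k → shift f k ≡ shift g k
shift-cong f≗g zero    = refl
shift-cong f≗g (suc k) = f≗g k

eval-cong : ∀ d {f g : ℕ → ℤ} x → (∀ m → f m ≡ g m) → eval d f x ≡ eval d g x
eval-cong zero    x f≗g = refl
eval-cong (suc d) x f≗g = cong₂ (λ a e → a + x * e) (f≗g zero) (eval-cong d x (f≗g ∘ suc))

eval-shift : ∀ d f x → eval (suc d) (shift f) x ≡ x * eval d f x
eval-shift d f x = ℤ.+-identityˡ (x * eval d f x)

eval-+ : ∀ d (f g : ℕ → ℤ) x → eval d (λ m → f m + g m) x ≡ eval d f x + eval d g x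
eval-+ zero    f g x = refl
eval-+ (suc d) f g x = begin
  f zero + g zero + x * eval d (λ m → f (suc m) + g (suc m)) x
    ≡⟨ cong (λ e → f zero + g zero + x * e) (eval-+ d (f ∘ suc) (g ∘ suc) x) ⟩
  f zero + g zero + x * (eval d (f ∘ suc) x + eval d (g ∘ suc) x)
    ≡⟨ lemma (f zero) (g zero) x _ _ ⟩
  f zero + x * eval d (f ∘ suc) x + (g zero + x * eval d (g ∘ suc) x) ∎
  where
  lemma : ∀ a b x e e′ → a + b + x * (e + e′) ≡ a + x * e + (b + x * e′)
  lemma = solve-∀

eval-*ˡ : ∀ d a (f : ℕ → ℤ) x → eval d (λ m → a * f m) x ≡ a * eval d f x
eval-*ˡ zero    a f x = sym (ℤ.*-zeroʳ a)
eval-*ˡ (suc d) a f x = begin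
  a * f zero + x * eval d (λ m → a * f (suc m)) x ≡⟨ cong (λ e → a * f zero + x * e) (eval-*ˡ d a (f ∘ suc) x) ⟩
  a * f zero + x * (a * eval d (f ∘ suc) x)        ≡⟨ lemma a (f zero) x _ ⟩
  a * (f zero + x * eval d (f ∘ suc) x)            ∎
  where
  lemma : ∀ a b x e → a * b + x * (a * e) ≡ a * (b + x * e)
  lemma = solve-∀

eval-*ʳ : ∀ d a (f : ℕ → ℤ) x → eval d (λ m → f m * a) x ≡ eval d f x * a
eval-*ʳ d a f x = begin
  eval d (λ m → f m * a) x ≡⟨ eval-cong d x (λ m → ℤ.*-comm (f m) a) ⟩
  eval d (λ m → a * f m) x ≡⟨ eval-*ˡ d a f x ⟩
  a * eval d f x           ≡⟨ ℤ.*-comm a (eval d f x) ⟩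
  eval d f x * a           ∎

eval-sum : ∀ {n} d (F : Fin n → ℕ → ℤ) x → eval d (λ m → sumℤ (λ j → F j m)) x ≡ sumℤ (λ j → eval d (F j) x)
eval-sum {n} zero F x = sym (sumℤ-zero {n} (const (+ 0)) λ _ → refl)
eval-sum (suc d) F x = begin
  sumℤ (λ j → F j zero) + x * eval d (λ m → sumℤ (λ j → F j (suc m))) x
    ≡⟨ cong (λ e → sumℤ (λ j → F j zero) + x * e) (eval-sum d (λ j → F j ∘ suc) x) ⟩
  sumℤ (λ j → F j zero) + x * sumℤ (λ j → eval d (F j ∘ suc) x)
    ≡⟨ cong (_+_ (sumℤ (λ j → F j zero))) (*-distribˡ-sumℤ x (λ j → eval d (F j ∘ suc) x)) ⟩
  sumℤ (λ j → F j zero) + sumℤ (λ j → x * eval d (F j ∘ suc) x)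
    ≡⟨ sumℤ-+ (λ j → F j zero) (λ j → x * eval d (F j ∘ suc) x) ⟨
  sumℤ (λ j → F j zero + x * eval d (F j ∘ suc) x) ∎

eval-extend : ∀ d f x → f d ≡ + 0 → eval (suc d) f x ≡ eval d f x
eval-extend zero    f x f₀≡0 = trans (cong (λ a → a + x * + 0) f₀≡0) (lemma x)
  where
  lemma : ∀ x → + 0 + x * + 0 ≡ + 0
  lemma = solve-∀
eval-extend (suc d) f x f≡0 = cong (λ e → f zero + x * e) (eval-extend d (f ∘ suc) x f≡0)

eval-beyond-degree : ∀ {d d′} f x → d ≤ d′ → (∀ m → d ≤ m → f m ≡ + 0) → eval d′ f x ≡ eval d f x
eval-beyond-degree {d} {d′} f x d≤d′ f≡0 with ℕ.m≤n⇒m<n∨m≡n d≤d′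
... | inj₂ refl = refl
... | inj₁ (s≤s d≤d″) = trans (eval-extend _ f x (f≡0 _ d≤d″)) (eval-beyond-degree f x d≤d″ f≡0)

m≡[1+m]*n⇒m≡0 : ∀ m n → m ≡ suc m ℕ.* n → m ≡ 0
m≡[1+m]*n⇒m≡0 m zero    eq = trans eq (ℕ.*-zeroʳ (suc m))
m≡[1+m]*n⇒m≡0 m (suc n) eq =
  ⊥-elim (ℕ.<-irrefl refl (ℕ.≤-trans (ℕ.m≤m*n (suc m) (suc n)) (ℕ.≤-reflexive (sym eq))))

-- At x = 1 + ∣f₀∣ we get f₀ = - x e, so ∣f₀∣ is a multiple of 1 + ∣f₀∣, hence 0; then cancel x.
eval≡0⇒coeff≡0 : ∀ d f → (∀ x → x ≢ + 0 → eval d f x ≡ + 0) → ∀ {m} → m < d → f m ≡ + 0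
eval≡0⇒coeff≡0 (suc d) f eval≡0 {zero} _ = ℤ.∣i∣≡0⇒i≡0 (m≡[1+m]*n⇒m≡0 ∣ f zero ∣ ∣ e ∣ ∣f₀∣≡x∣e∣)
  where
  x = + suc ∣ f zero ∣
  e = eval d (f ∘ suc) x
  f₀≡-xe : f zero ≡ - (x * e)
  f₀≡-xe = begin
    f zero                     ≡⟨ lemma (f zero) (x * e) ⟩
    (f zero + x * e) - x * e   ≡⟨ cong (_- x * e) (eval≡0 x λ ()) ⟩
    + 0 - x * e                ≡⟨ ℤ.+-identityˡ (- (x * e)) ⟩
    - (x * e)                  ∎
    where
    lemma : ∀ a b → a ≡ (a + b) - b
    lemma = solve-∀
  ∣f₀∣≡x∣e∣ : ∣ f zero ∣ ≡ suc ∣ f zero ∣ ℕ.* ∣ e ∣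
  ∣f₀∣≡x∣e∣ = trans (cong ∣_∣ f₀≡-xe) (trans (ℤ.∣-i∣≡∣i∣ (x * e)) (ℤ.abs-* x e))
eval≡0⇒coeff≡0 (suc d) f eval≡0 {suc m} (s≤s m<d) = eval≡0⇒coeff≡0 d (f ∘ suc) tail≡0 m<d
  where
  f₀≡0 : f zero ≡ + 0
  f₀≡0 = eval≡0⇒coeff≡0 (suc d) f eval≡0 (s≤s z≤n)
  tail≡0 : ∀ x → x ≢ + 0 → eval d (f ∘ suc) x ≡ + 0
  tail≡0 x x≢0 with ℤ.i*j≡0⇒i≡0∨j≡0 x x*e≡0
    where
    x*e≡0 : x * eval d (f ∘ suc) x ≡ + 0
    x*e≡0 = begin
      x * eval d (f ∘ suc) x              ≡⟨ ℤ.+-identityˡ _ ⟨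
      + 0 + x * eval d (f ∘ suc) x        ≡⟨ cong (_+ x * eval d (f ∘ suc) x) f₀≡0 ⟨
      eval (suc d) f x                    ≡⟨ eval≡0 x x≢0 ⟩
      + 0                                 ∎
  ... | inj₁ x≡0 = ⊥-elim (x≢0 x≡0)
  ... | inj₂ e≡0 = e≡0

eval-injective : ∀ d (f g : ℕ → ℤ) → (∀ x → x ≢ + 0 → eval d f x ≡ eval d g x) → ∀ {m} → m < d → f m ≡ g m
eval-injective d f g eval≡ {m} m<d = ℤ.i-j≡0⇒i≡j (f m) (g m) (eval≡0⇒coeff≡0 d (λ m → f m - g m) eval-diff≡0 m<d)
  where
  eval-diff≡0 : ∀ x → x ≢ + 0 → eval d (λ m → f m - g m) x ≡ + 0
  eval-diff≡0 x x≢0 = begin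
    eval d (λ m → f m - g m) x                 ≡⟨ eval-+ d f (λ m → - g m) x ⟩
    eval d f x + eval d (λ m → - g m) x
      ≡⟨ cong (_+_ (eval d f x)) (trans (eval-cong d x (λ m → sym (ℤ.-1*i≡-i (g m)))) (eval-*ˡ d (- + 1) g x)) ⟩
    eval d f x + - + 1 * eval d g x            ≡⟨ cong (λ e → eval d f x + - + 1 * e) (eval≡ x x≢0) ⟨
    eval d f x + - + 1 * eval d f x            ≡⟨ lemma (eval d f x) ⟩
    + 0                                        ∎
    where
    lemma : ∀ a → a + - + 1 * a ≡ + 0
    lemma = solve-∀

-- Matrix pencils

-- detCoeff D C k is the coefficient of xᵏ in det (x D + C).
detCoeff : ∀ {n} → Matrix ℤ n → Matrix ℤ n → ℕ → ℤ
detCoeff {zero}  D C zero    = + 1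
detCoeff {zero}  D C (suc k) = + 0
detCoeff {suc n} D C k = sumℤ λ j →
  sign j * (D zero j * shift (detCoeff (minor D j) (minor C j)) k + C zero j * detCoeff (minor D j) (minor C j) k)

detCoeff-cong : ∀ {n} {D D′ C C′ : Matrix ℤ n} → (∀ r c → D r c ≡ D′ r c) → (∀ r c → C r c ≡ C′ r c) →
                ∀ k → detCoeff D C k ≡ detCoeff D′ C′ k
detCoeff-cong {zero}  D≗D′ C≗C′ zero    = refl
detCoeff-cong {zero}  D≗D′ C≗C′ (suc k) = refl
detCoeff-cong {suc n} {D} {D′} {C} {C′} D≗D′ C≗C′ k = sumℤ-cong λ j →
  cong₂ (λ a b → sign j * (a + b))
        (cong₂ _*_ (D≗D′ zero j) (shift-cong (minors≡ j) k))
        (cong₂ _*_ (C≗C′ zero j) (minors≡ j k))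
  where
  minors≡ : ∀ j k → detCoeff (minor D j) (minor C j) k ≡ detCoeff (minor D′ j) (minor C′ j) k
  minors≡ j = detCoeff-cong (λ r c → D≗D′ (suc r) (punchIn j c)) (λ r c → C≗C′ (suc r) (punchIn j c))

private
  s*[a*0+b*0]≡0 : ∀ s a b → s * (a * + 0 + b * + 0) ≡ + 0
  s*[a*0+b*0]≡0 = solve-∀

detCoeff-above : ∀ {n} (D C : Matrix ℤ n) {k} → n < k → detCoeff D C k ≡ + 0
detCoeff-above {zero}  D C {suc k} _         = refl
detCoeff-above {suc n} D C {suc k} (s≤s n<k) = sumℤ-zero _ λ j → begin
  sign j * (D zero j * detCoeff (minor D j) (minor C j) k + C zero j * detCoeff (minor D j) (minor C j) (suc k))
    ≡⟨ cong₂ (λ a b → sign j * (D zero j * a + C zero j * b))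
             (detCoeff-above (minor D j) (minor C j) n<k)
             (detCoeff-above (minor D j) (minor C j) (ℕ.m<n⇒m<1+n n<k)) ⟩
  sign j * (D zero j * + 0 + C zero j * + 0)
    ≡⟨ s*[a*0+b*0]≡0 (sign j) (D zero j) (C zero j) ⟩
  + 0 ∎

detCoeff-zero-row : ∀ {n} (D C : Matrix ℤ n) i → (∀ c → D i c ≡ + 0) → ∀ {k} → n ≤ k → detCoeff D C k ≡ + 0
detCoeff-zero-row {suc n} D C zero    row≡0 {k} n<k = sumℤ-zero _ λ j → begin
  sign j * (D zero j * shift (detCoeff (minor D j) (minor C j)) k + C zero j * detCoeff (minor D j) (minor C j) k)
    ≡⟨ cong₂ (λ a b → sign j * (a * shift (detCoeff (minor D j) (minor C j)) k + C zero j * b))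
             (row≡0 j) (detCoeff-above (minor D j) (minor C j) n<k) ⟩
  sign j * (+ 0 * shift (detCoeff (minor D j) (minor C j)) k + C zero j * + 0)
    ≡⟨ lemma (sign j) (shift (detCoeff (minor D j) (minor C j)) k) (C zero j) ⟩
  + 0 ∎
  where
  lemma : ∀ s a b → s * (+ 0 * a + b * + 0) ≡ + 0
  lemma = solve-∀
detCoeff-zero-row {suc n} D C (suc i) row≡0 {suc k} (s≤s n≤k) = sumℤ-zero _ λ j → begin
  sign j * (D zero j * detCoeff (minor D j) (minor C j) k + C zero j * detCoeff (minor D j) (minor C j) (suc k))
    ≡⟨ cong₂ (λ a b → sign j * (D zero j * a + C zero j * b))
             (detCoeff-zero-row (minor D j) (minor C j) i (row≡0 ∘ punchIn j) n≤k)
             (detCoeff-zero-row (minor D j) (minor C j) i (row≡0 ∘ punchIn j) (ℕ.m≤n⇒m≤1+n n≤k)) ⟩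
  sign j * (D zero j * + 0 + C zero j * + 0)
    ≡⟨ s*[a*0+b*0]≡0 (sign j) (D zero j) (C zero j) ⟩
  + 0 ∎

detCoeff-leading : ∀ {n} (D C C′ : Matrix ℤ n) → detCoeff D C n ≡ detCoeff D C′ n
detCoeff-leading {zero}  D C C′ = refl
detCoeff-leading {suc n} D C C′ = sumℤ-cong λ j → cong₂ (λ a b → sign j * (D zero j * a + b))
  (detCoeff-leading (minor D j) (minor C j) (minor C′ j))
  (begin
    C zero j * detCoeff (minor D j) (minor C j) (suc n)   ≡⟨ cong (C zero j *_) (detCoeff-above _ _ (ℕ.n<1+n n)) ⟩
    C zero j * + 0                                        ≡⟨ ℤ.*-zeroʳ (C zero j) ⟩
    + 0                                                   ≡⟨ ℤ.*-zeroʳ (C′ zero j) ⟨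
    C′ zero j * + 0                                       ≡⟨ cong (C′ zero j *_) (detCoeff-above _ _ (ℕ.n<1+n n)) ⟨
    C′ zero j * detCoeff (minor D j) (minor C′ j) (suc n) ∎)

det-eval : ∀ {n} (D C : Matrix ℤ n) x → det (λ r c → x * D r c + C r c) ≡ eval (suc n) (detCoeff D C) x
det-eval {zero}  D C x = sym (lemma x)
  where
  lemma : ∀ x → + 1 + x * + 0 ≡ + 1
  lemma = solve-∀
det-eval {suc n} D C x = begin
  sumℤ (λ j → sign j * ((x * D zero j + C zero j) * det (λ r c → x * minor D j r c + minor C j r c)))
    ≡⟨ sumℤ-cong (λ j → cong (λ e → sign j * ((x * D zero j + C zero j) * e))
                             (det-eval (minor D j) (minor C j) x)) ⟩
  sumℤ (λ j → sign j * ((x * D zero j + C zero j) * E j))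
    ≡⟨ sumℤ-cong term-eval ⟨
  sumℤ (λ j → eval (suc (suc n)) (term j) x)
    ≡⟨ eval-sum (suc (suc n)) term x ⟨
  eval (suc (suc n)) (detCoeff D C) x ∎
  where
  cf : Fin (suc n) → ℕ → ℤ
  cf j = detCoeff (minor D j) (minor C j)
  E : Fin (suc n) → ℤ
  E j = eval (suc n) (cf j) x
  term : Fin (suc n) → ℕ → ℤ
  term j k = sign j * (D zero j * shift (cf j) k + C zero j * cf j k)
  term-eval : ∀ j → eval (suc (suc n)) (term j) x ≡ sign j * ((x * D zero j + C zero j) * E j)
  term-eval j = begin
    eval (suc (suc n)) (term j) x
      ≡⟨ eval-*ˡ (suc (suc n)) (sign j) (λ k → D zero j * shift (cf j) k + C zero j * cf j k) x ⟩
    sign j * eval (suc (suc n)) (λ k → D zero j * shift (cf j) k + C zero j * cf j k) x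
      ≡⟨ cong (sign j *_) (eval-+ (suc (suc n)) (λ k → D zero j * shift (cf j) k) (λ k → C zero j * cf j k) x) ⟩
    sign j * (eval (suc (suc n)) (λ k → D zero j * shift (cf j) k) x + eval (suc (suc n)) (λ k → C zero j * cf j k) x)
      ≡⟨ cong₂ (λ a b → sign j * (a + b)) (eval-*ˡ (suc (suc n)) (D zero j) (shift (cf j)) x)
                                          (eval-*ˡ (suc (suc n)) (C zero j) (cf j) x) ⟩
    sign j * (D zero j * eval (suc (suc n)) (shift (cf j)) x + C zero j * eval (suc (suc n)) (cf j) x)
      ≡⟨ cong₂ (λ a b → sign j * (D zero j * a + C zero j * b))
               (eval-shift (suc n) (cf j) x)
               (eval-extend (suc n) (cf j) x (detCoeff-above (minor D j) (minor C j) (ℕ.n<1+n n))) ⟩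
    sign j * (D zero j * (x * E j) + C zero j * E j)
      ≡⟨ lemma (sign j) (D zero j) (C zero j) x (E j) ⟩
    sign j * ((x * D zero j + C zero j) * E j) ∎
    where
    lemma : ∀ s d c x e → s * (d * (x * e) + c * e) ≡ s * ((x * d + c) * e)
    lemma = solve-∀

-- ∂detCoeff D C i k is the coefficient of xᵏ in det (x D + C) with row i replaced by row i of D;
-- summed over i these are the coefficients of the derivative (Jacobi's formula).
∂detCoeff : ∀ {n} → Matrix ℤ n → Matrix ℤ n → Fin n → ℕ → ℤ
∂detCoeff D C i = detCoeff (D [ i ]≔ const (+ 0)) (C [ i ]≔ D i)

∂detCoeff-suc : ∀ {n} (D C : Matrix ℤ (suc n)) i k →
  ∂detCoeff D C (suc i) k ≡ sumℤ λ j →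
    sign j * (D zero j * shift (∂detCoeff (minor D j) (minor C j) i) k + C zero j * ∂detCoeff (minor D j) (minor C j) i k)
∂detCoeff-suc D C i k = sumℤ-cong λ j →
  cong₂ (λ p q → sign j * (D zero j * p + C zero j * q)) (shift-cong (minors≡ j) k) (minors≡ j k)
  where
  minors≡ : ∀ j k → detCoeff (minor (D [ suc i ]≔ const (+ 0)) j) (minor (C [ suc i ]≔ D (suc i)) j) k
                  ≡ ∂detCoeff (minor D j) (minor C j) i k
  minors≡ j = detCoeff-cong (minor-[]≔ D i (const (+ 0)) j) (minor-[]≔ C i (D (suc i)) j)

jacobi : ∀ {n} (D C : Matrix ℤ n) k → + suc k * detCoeff D C (suc k) ≡ sumℤ (λ i → ∂detCoeff D C i k)

jacobi-shift : ∀ {n} (D C : Matrix ℤ n) k → sumℤ (λ i → shift (∂detCoeff D C i) k) ≡ + k * detCoeff D C k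

jacobi {zero}  D C k = ℤ.*-zeroʳ (+ suc k)
jacobi {suc n} D C k = begin
  + suc k * sumℤ (λ j → sign j * (D zero j * A j + C zero j * B j))
    ≡⟨ *-distribˡ-sumℤ (+ suc k) (λ j → sign j * (D zero j * A j + C zero j * B j)) ⟩
  sumℤ (λ j → + suc k * (sign j * (D zero j * A j + C zero j * B j)))
    ≡⟨ sumℤ-cong (λ j → lemma (+ k) (sign j) (D zero j) (C zero j) (A j) (B j) (shift (cf j) k)) ⟩
  sumℤ (λ j → sign j * (+ 0 * shift (cf j) k + D zero j * A j) + rest j)
    ≡⟨ sumℤ-+ (λ j → sign j * (+ 0 * shift (cf j) k + D zero j * A j)) rest ⟩
  ∂detCoeff D C zero k + sumℤ rest
    ≡⟨ cong (_+_ (∂detCoeff D C zero k)) rows-below-0 ⟨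
  ∂detCoeff D C zero k + sumℤ (λ i → ∂detCoeff D C (suc i) k) ∎
  where
  cf : Fin (suc n) → ℕ → ℤ
  cf j = detCoeff (minor D j) (minor C j)
  A B rest : Fin (suc n) → ℤ
  A j = cf j k
  B j = cf j (suc k)
  rest j = sign j * (D zero j * (+ k * A j) + C zero j * (+ suc k * B j))
  lemma : ∀ k s d c a b p →
          (+ 1 + k) * (s * (d * a + c * b)) ≡ s * (+ 0 * p + d * a) + s * (d * (k * a) + c * ((+ 1 + k) * b))
  lemma = solve-∀

  P Q : Fin n → Fin (suc n) → ℤ
  P i j = shift (∂detCoeff (minor D j) (minor C j) i) k
  Q i j = ∂detCoeff (minor D j) (minor C j) i k

  rows-below-0 : sumℤ (λ i → ∂detCoeff D C (suc i) k) ≡ sumℤ rest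
  rows-below-0 = begin
    sumℤ (λ i → ∂detCoeff D C (suc i) k)
      ≡⟨ sumℤ-cong (λ i → ∂detCoeff-suc D C i k) ⟩
    sumℤ (λ i → sumℤ (λ j → sign j * (D zero j * P i j + C zero j * Q i j)))
      ≡⟨ sumℤ-comm (λ i j → sign j * (D zero j * P i j + C zero j * Q i j)) ⟩
    sumℤ (λ j → sumℤ (λ i → sign j * (D zero j * P i j + C zero j * Q i j)))
      ≡⟨ sumℤ-cong (λ j → sumℤ-linear₂ (sign j) (D zero j) (C zero j) (λ i → P i j) (λ i → Q i j)) ⟩
    sumℤ (λ j → sign j * (D zero j * sumℤ (λ i → P i j) + C zero j * sumℤ (λ i → Q i j)))
      ≡⟨ sumℤ-cong (λ j → cong₂ (λ p q → sign j * (D zero j * p + C zero j * q))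
                                (jacobi-shift (minor D j) (minor C j) k) (sym (jacobi (minor D j) (minor C j) k))) ⟩
    sumℤ rest ∎

jacobi-shift {n} D C zero    = trans (sumℤ-zero {n} _ λ _ → refl) (sym (ℤ.*-zeroˡ (detCoeff D C zero)))
jacobi-shift     D C (suc k) = sym (jacobi D C k)

-- Newton's identities

infixl 7 _*ᴹ_
infixr 8 _^ᴹ_

_*ᴹ_ : ∀ {n} → Matrix ℤ n → Matrix ℤ n → Matrix ℤ n
(M *ᴹ N) i k = sumℤ (λ j → M i j * N j k)

_^ᴹ_ : ∀ {n} → Matrix ℤ n → ℕ → Matrix ℤ n
M ^ᴹ zero  = δ
M ^ᴹ suc s = M *ᴹ M ^ᴹ s

trace : ∀ {n} → Matrix ℤ n → ℤ
trace M = sumℤ (λ i → M i i)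

*ᴹ-assoc : ∀ {n} (L M N : Matrix ℤ n) i k → ((L *ᴹ M) *ᴹ N) i k ≡ (L *ᴹ (M *ᴹ N)) i k
*ᴹ-assoc L M N i k = begin
  sumℤ (λ l → sumℤ (λ j → L i j * M j l) * N l k)
    ≡⟨ sumℤ-cong (λ l → trans (ℤ.*-comm _ (N l k)) (*-distribˡ-sumℤ (N l k) (λ j → L i j * M j l))) ⟩
  sumℤ (λ l → sumℤ (λ j → N l k * (L i j * M j l)))
    ≡⟨ sumℤ-comm (λ l j → N l k * (L i j * M j l)) ⟩
  sumℤ (λ j → sumℤ (λ l → N l k * (L i j * M j l)))
    ≡⟨ sumℤ-cong (λ j → sumℤ-cong λ l → lemma (N l k) (L i j) (M j l)) ⟩
  sumℤ (λ j → sumℤ (λ l → L i j * (M j l * N l k)))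
    ≡⟨ sumℤ-cong (λ j → *-distribˡ-sumℤ (L i j) (λ l → M j l * N l k)) ⟨
  sumℤ (λ j → L i j * sumℤ (λ l → M j l * N l k)) ∎
  where
  lemma : ∀ a b c → a * (b * c) ≡ b * (c * a)
  lemma = solve-∀

charCoeff : ∀ {n} → Matrix ℤ n → ℕ → ℤ
charCoeff A = detCoeff δ (λ i j → - A i j)

module Newton {n} (A : Matrix ℤ n) (A-sym : ∀ i j → A i j ≡ A j i) where

  negA : Matrix ℤ n
  negA i j = - A i j

  xI-A : ℤ → Matrix ℤ n
  xI-A x i j = x * δ i j + negA i j

  χ : ℕ → ℤ
  χ = charCoeff A

  -- cofCoeff m i j is the coefficient of xᵐ in the cofactor of the entry (i, j) of x I − A.
  cofCoeff : ℕ → Matrix ℤ n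
  cofCoeff m i j = detCoeff (δ [ i ]≔ const (+ 0)) (negA [ i ]≔ δ j) m

  p : ℕ → ℤ
  p s = trace (A ^ᴹ s)

  cofactor : ℤ → Fin n → Fin n → ℤ
  cofactor x i j = det (xI-A x [ i ]≔ δ j)

  cofCoeff-above : ∀ {m} i j → n ≤ m → cofCoeff m i j ≡ + 0
  cofCoeff-above i j = detCoeff-zero-row _ _ i (λ c → cong-app (updateAt-updates i δ) c)

  eval-χ : ∀ {d} x → suc n ≤ d → eval d χ x ≡ det (xI-A x)
  eval-χ x n<d = trans (eval-beyond-degree χ x n<d (λ _ → detCoeff-above δ negA)) (sym (det-eval δ negA x))

  eval-cofCoeff : ∀ {d} x i j → suc n ≤ d → eval d (λ m → cofCoeff m i j) x ≡ cofactor x i j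
  eval-cofCoeff {d} x i j n<d = begin
    eval d (λ m → cofCoeff m i j) x
      ≡⟨ eval-beyond-degree (λ m → cofCoeff m i j) x n<d (λ _ → cofCoeff-above i j ∘ ℕ.<⇒≤) ⟩
    eval (suc n) (λ m → cofCoeff m i j) x ≡⟨ det-eval (δ [ i ]≔ const (+ 0)) (negA [ i ]≔ δ j) x ⟨
    det (λ r c → x * (δ [ i ]≔ const (+ 0)) r c + (negA [ i ]≔ δ j) r c)
                                     ≡⟨ det-cong rows ⟩
    cofactor x i j                   ∎
    where
    rows : ∀ r c → x * (δ [ i ]≔ const (+ 0)) r c + (negA [ i ]≔ δ j) r c ≡ (xI-A x [ i ]≔ δ j) r c
    rows r c with r ≟ i
    ... | yes refl = begin
      x * (δ [ r ]≔ const (+ 0)) r c + (negA [ r ]≔ δ j) r c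
        ≡⟨ cong₂ (λ a b → x * a + b) (cong-app (updateAt-updates r δ) c)
                                     (cong-app (updateAt-updates r negA) c) ⟩
      x * + 0 + δ j c            ≡⟨ cong (_+ δ j c) (ℤ.*-zeroʳ x) ⟩
      + 0 + δ j c                ≡⟨ ℤ.+-identityˡ (δ j c) ⟩
      δ j c                      ≡⟨ cong-app (updateAt-updates r (xI-A x)) c ⟨
      (xI-A x [ r ]≔ δ j) r c    ∎
    ... | no r≢i = begin
      x * (δ [ i ]≔ const (+ 0)) r c + (negA [ i ]≔ δ j) r c
        ≡⟨ cong₂ (λ a b → x * a + b) (cong-app (updateAt-minimal r i δ r≢i) c)
                                     (cong-app (updateAt-minimal r i negA r≢i) c) ⟩
      xI-A x r c                 ≡⟨ cong-app (updateAt-minimal r i (xI-A x) r≢i) c ⟨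
      (xI-A x [ i ]≔ δ j) r c    ∎

  -- Expansion along row i gives Σⱼ (xI − A)ₖⱼ cofactor x i j = δᵢₖ det (xI − A); the symmetry of A
  -- turns this into the product cofactor · (xI − A) that the trace computations below need.
  cofactor-identity : ∀ x i k → x * cofactor x i k ≡ δ i k * det (xI-A x) + sumℤ (λ j → cofactor x i j * A j k)
  cofactor-identity x i k = lemma (x * cofactor x i k) (δ i k * det (xI-A x)) S (begin
    δ i k * det (xI-A x)
      ≡⟨ cofactor-expansion (xI-A x) i k ⟨
    sumℤ (λ j → (x * δ k j + - A k j) * cofactor x i j)
      ≡⟨ sumℤ-cong (λ j → trans (cong (λ a → (x * δ k j + - a) * cofactor x i j) (A-sym k j))
                                (lemma′ x (δ k j) (A j k) (cofactor x i j))) ⟩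
    sumℤ (λ j → x * (δ k j * cofactor x i j) + - (cofactor x i j * A j k))
      ≡⟨ sumℤ-+ (λ j → x * (δ k j * cofactor x i j)) (λ j → - (cofactor x i j * A j k)) ⟩
    sumℤ (λ j → x * (δ k j * cofactor x i j)) + sumℤ (λ j → - (cofactor x i j * A j k))
      ≡⟨ cong₂ _+_ (*-distribˡ-sumℤ x (λ j → δ k j * cofactor x i j))
                   (sym (sumℤ-neg (λ j → cofactor x i j * A j k))) ⟨
    x * sumℤ (λ j → δ k j * cofactor x i j) + - S
      ≡⟨ cong (λ a → x * a + - S) (sumℤ-δˡ (cofactor x i) k) ⟩
    x * cofactor x i k + - S ∎)
    where
    S = sumℤ (λ j → cofactor x i j * A j k)
    lemma : ∀ a b s → b ≡ a + - s → a ≡ b + s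
    lemma a b s b≡a-s = trans (lemma″ a s) (cong (_+ s) (sym b≡a-s))
      where
      lemma″ : ∀ a s → a ≡ a + - s + s
      lemma″ = solve-∀
    lemma′ : ∀ x d a e → (x * d + - a) * e ≡ x * (d * e) + - (e * a)
    lemma′ = solve-∀

  cofCoeff-identity : ∀ m i k → shift (λ m → cofCoeff m i k) m ≡ δ i k * χ m + (cofCoeff m *ᴹ A) i k
  cofCoeff-identity m i k =
    eval-injective (suc d) (shift (λ m → cofCoeff m i k)) rhs evals≡ (s≤s (ℕ.m≤n+m m (suc n)))
    where
    d = suc n ℕ.+ m
    n<d : suc n ≤ d
    n<d = ℕ.m≤m+n (suc n) m
    rhs : ℕ → ℤ
    rhs m = δ i k * χ m + sumℤ (λ j → cofCoeff m i j * A j k)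
    evals≡ : ∀ x → x ≢ + 0 → eval (suc d) (shift (λ m → cofCoeff m i k)) x ≡ eval (suc d) rhs x
    evals≡ x _ = begin
      eval (suc d) (shift (λ m → cofCoeff m i k)) x
        ≡⟨ eval-shift d (λ m → cofCoeff m i k) x ⟩
      x * eval d (λ m → cofCoeff m i k) x
        ≡⟨ cong (x *_) (eval-cofCoeff x i k n<d) ⟩
      x * cofactor x i k
        ≡⟨ cofactor-identity x i k ⟩
      δ i k * det (xI-A x) + sumℤ (λ j → cofactor x i j * A j k)
        ≡⟨ cong₂ (λ a b → δ i k * a + b) (eval-χ x (ℕ.m≤n⇒m≤1+n n<d))
                 (sumℤ-cong λ j → cong (_* A j k) (eval-cofCoeff x i j (ℕ.m≤n⇒m≤1+n n<d))) ⟨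
      δ i k * eval (suc d) χ x + sumℤ (λ j → eval (suc d) (λ m → cofCoeff m i j) x * A j k)
        ≡⟨ cong₂ _+_ (eval-*ˡ (suc d) (δ i k) χ x)
                     (trans (eval-sum (suc d) (λ j m → cofCoeff m i j * A j k) x)
                            (sumℤ-cong λ j → eval-*ʳ (suc d) (A j k) (λ m → cofCoeff m i j) x)) ⟨
      eval (suc d) (λ m → δ i k * χ m) x + eval (suc d) (λ m → sumℤ (λ j → cofCoeff m i j * A j k)) x
        ≡⟨ eval-+ (suc d) (λ m → δ i k * χ m) (λ m → sumℤ (λ j → cofCoeff m i j * A j k)) x ⟨
      eval (suc d) rhs x ∎

  trace-step : ∀ m s → trace (cofCoeff m *ᴹ A ^ᴹ s) ≡ χ (suc m) * p s + trace (cofCoeff (suc m) *ᴹ A ^ᴹ suc s)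
  trace-step m s = begin
    sumℤ (λ i → sumℤ (λ k → cofCoeff m i k * P k i))
      ≡⟨ sumℤ-cong (λ i → sumℤ-cong λ k → cong (_* P k i) (cofCoeff-identity (suc m) i k)) ⟩
    sumℤ (λ i → sumℤ (λ k → (δ i k * χ′ + (N *ᴹ A) i k) * P k i))
      ≡⟨ sumℤ-cong (λ i → trans (sumℤ-cong λ k → lemma (δ i k) χ′ ((N *ᴹ A) i k) (P k i))
                                (sumℤ-+ (λ k → δ i k * (χ′ * P k i)) (λ k → (N *ᴹ A) i k * P k i))) ⟩
    sumℤ (λ i → sumℤ (λ k → δ i k * (χ′ * P k i)) + ((N *ᴹ A) *ᴹ P) i i)
      ≡⟨ sumℤ-linear χ′ (λ i → P i i) (λ i → (N *ᴹ (A *ᴹ P)) i i) _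
                     (λ i → cong₂ _+_ (sumℤ-δˡ (λ k → χ′ * P k i) i) (*ᴹ-assoc N A P i i)) ⟩
    χ′ * p s + trace (N *ᴹ A ^ᴹ suc s) ∎
    where
    χ′ = χ (suc m)
    N = cofCoeff (suc m)
    P = A ^ᴹ s
    lemma : ∀ d a b e → (d * a + b) * e ≡ d * (a * e) + b * e
    lemma = solve-∀

  trace-expansion : ∀ d m s → trace (cofCoeff m *ᴹ A ^ᴹ s) ≡
                    sumℤ {d} (λ t → χ (suc (toℕ t ℕ.+ m)) * p (toℕ t ℕ.+ s))
                    + trace (cofCoeff (d ℕ.+ m) *ᴹ A ^ᴹ (d ℕ.+ s))
  trace-expansion zero    m s = sym (ℤ.+-identityˡ _)
  trace-expansion (suc d) m s = begin
    trace (cofCoeff m *ᴹ A ^ᴹ s)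
      ≡⟨ trace-step m s ⟩
    χ (suc m) * p s + trace (cofCoeff (suc m) *ᴹ A ^ᴹ suc s)
      ≡⟨ cong (_+_ (χ (suc m) * p s)) (trace-expansion d (suc m) (suc s)) ⟩
    χ (suc m) * p s + (sumℤ {d} (λ t → χ (suc (toℕ t ℕ.+ suc m)) * p (toℕ t ℕ.+ suc s))
                       + trace (cofCoeff (d ℕ.+ suc m) *ᴹ A ^ᴹ (d ℕ.+ suc s)))
      ≡⟨ cong₂ (λ a b → χ (suc m) * p s + (a + b))
               (sumℤ-cong {d} λ t → cong₂ (λ u v → χ (suc u) * p v) (ℕ.+-suc (toℕ t) m) (ℕ.+-suc (toℕ t) s))
               (cong₂ (λ u v → trace (cofCoeff u *ᴹ A ^ᴹ v)) (ℕ.+-suc d m) (ℕ.+-suc d s)) ⟩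
    χ (suc m) * p s + (sumℤ {d} (λ t → χ (suc (suc (toℕ t) ℕ.+ m)) * p (suc (toℕ t) ℕ.+ s))
                       + trace (cofCoeff (suc d ℕ.+ m) *ᴹ A ^ᴹ (suc d ℕ.+ s)))
      ≡⟨ ℤ.+-assoc (χ (suc m) * p s) _ _ ⟨
    sumℤ {suc d} (λ t → χ (suc (toℕ t ℕ.+ m)) * p (toℕ t ℕ.+ s))
    + trace (cofCoeff (suc d ℕ.+ m) *ᴹ A ^ᴹ (suc d ℕ.+ s)) ∎

  trace-cofCoeff : ∀ m s →
                   trace (cofCoeff m *ᴹ A ^ᴹ s) ≡ sumℤ {n} (λ t → χ (suc (toℕ t ℕ.+ m)) * p (toℕ t ℕ.+ s))
  trace-cofCoeff m s = begin
    trace (cofCoeff m *ᴹ A ^ᴹ s)                        ≡⟨ trace-expansion n m s ⟩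
    S + trace (cofCoeff (n ℕ.+ m) *ᴹ A ^ᴹ (n ℕ.+ s))     ≡⟨ cong (_+_ S) remainder≡0 ⟩
    S + + 0                                            ≡⟨ ℤ.+-identityʳ S ⟩
    S                                                  ∎
    where
    S = sumℤ {n} (λ t → χ (suc (toℕ t ℕ.+ m)) * p (toℕ t ℕ.+ s))
    remainder≡0 : trace (cofCoeff (n ℕ.+ m) *ᴹ A ^ᴹ (n ℕ.+ s)) ≡ + 0
    remainder≡0 = sumℤ-zero _ λ i → sumℤ-zero _ λ k → begin
      cofCoeff (n ℕ.+ m) i k * (A ^ᴹ (n ℕ.+ s)) k i
        ≡⟨ cong (_* (A ^ᴹ (n ℕ.+ s)) k i) (cofCoeff-above i k (ℕ.m≤m+n n m)) ⟩
      + 0 * (A ^ᴹ (n ℕ.+ s)) k i                    ≡⟨ ℤ.*-zeroˡ ((A ^ᴹ (n ℕ.+ s)) k i) ⟩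
      + 0                                           ∎

  newton : ∀ m → (+ m - + n) * χ m ≡ sumℤ {n} (λ t → χ (suc (toℕ t ℕ.+ m)) * p (toℕ t ℕ.+ 1))
  newton m = trans (lemma (+ m) (+ n) (χ m) (trace (N *ᴹ A ^ᴹ 1)) m*χ≡) (trace-cofCoeff m 1)
    where
    N = cofCoeff m
    m*χ≡ : + m * χ m ≡ + n * χ m + trace (N *ᴹ A ^ᴹ 1)
    m*χ≡ = begin
      + m * χ m
        ≡⟨ jacobi-shift δ negA m ⟨
      sumℤ (λ i → shift (λ m → cofCoeff m i i) m)
        ≡⟨ sumℤ-cong (λ i → cofCoeff-identity m i i) ⟩
      sumℤ (λ i → δ i i * χ m + (N *ᴹ A) i i)
        ≡⟨ sumℤ-+ {n} (λ i → δ i i * χ m) (λ i → (N *ᴹ A) i i) ⟩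
      sumℤ {n} (λ i → δ i i * χ m) + trace (N *ᴹ A)
        ≡⟨ cong₂ _+_ (trans (sumℤ-cong {n} λ i → cong (λ a → + a * χ m) (idMat-diag i))
                            (trans (sumℤ-const n (+ 1 * χ m)) (cong (+ n *_) (ℤ.*-identityˡ (χ m)))))
                     (sumℤ-cong {n} λ i → sumℤ-cong λ j → cong (N i j *_) (sym (sumℤ-δʳ (A j) i))) ⟩
      + n * χ m + trace (N *ᴹ A ^ᴹ 1) ∎
    lemma : ∀ a b x t → a * x ≡ b * x + t → (a - b) * x ≡ t
    lemma a b x t eq = trans (lemma′ a b x) (trans (cong (λ y → y - b * x) eq) (lemma″ (b * x) t))
      where
      lemma′ : ∀ a b x → (a - b) * x ≡ a * x - b * x
      lemma′ = solve-∀
      lemma″ : ∀ y t → y + t - y ≡ t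
      lemma″ = solve-∀

traces≡⇒charCoeff≡ : ∀ {n} (A B : Matrix ℤ n) → (∀ i j → A i j ≡ A j i) → (∀ i j → B i j ≡ B j i) →
                        (∀ s → trace (A ^ᴹ s) ≡ trace (B ^ᴹ s)) → ∀ m → charCoeff A m ≡ charCoeff B m
traces≡⇒charCoeff≡ {n} A B A-sym B-sym traces≡ m = downward n m (ℕ.m≤m+n n m)
  where
  module NA = Newton A A-sym
  module NB = Newton B B-sym

  beyond-degree : ∀ m → n ≤ m → charCoeff A m ≡ charCoeff B m
  beyond-degree m n≤m with ℕ.m≤n⇒m<n∨m≡n n≤m
  ... | inj₁ n<m  = trans (detCoeff-above δ NA.negA n<m) (sym (detCoeff-above δ NB.negA n<m))
  ... | inj₂ refl = detCoeff-leading δ NA.negA NB.negA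

  -- For m < n, Newton's identity expresses the m-th coefficient through the next n ones.
  downward : ∀ d m → n ≤ d ℕ.+ m → charCoeff A m ≡ charCoeff B m
  downward zero    m n≤m = beyond-degree m n≤m
  downward (suc d) m n≤1+d+m with n ℕ.≤? m
  ... | yes n≤m = beyond-degree m n≤m
  ... | no  n≰m = ℤ.*-cancelˡ-≡ (+ m - + n) (charCoeff A m) (charCoeff B m) {{ℤ.≢-nonZero m-n≢0}} (begin
    (+ m - + n) * charCoeff A m
      ≡⟨ NA.newton m ⟩
    sumℤ {n} (λ t → charCoeff A (suc (toℕ t ℕ.+ m)) * trace (A ^ᴹ (toℕ t ℕ.+ 1)))
      ≡⟨ sumℤ-cong {n} (λ t → cong₂ _*_ (downward d (suc (toℕ t ℕ.+ m)) (n≤ t)) (traces≡ (toℕ t ℕ.+ 1))) ⟩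
    sumℤ {n} (λ t → charCoeff B (suc (toℕ t ℕ.+ m)) * trace (B ^ᴹ (toℕ t ℕ.+ 1)))
      ≡⟨ NB.newton m ⟨
    (+ m - + n) * charCoeff B m ∎)
    where
    m-n≢0 : + m - + n ≢ + 0
    m-n≢0 m-n≡0 = n≰m (ℕ.≤-reflexive (sym (ℤ.+-injective (ℤ.i-j≡0⇒i≡j (+ m) (+ n) m-n≡0))))
    n≤ : ∀ t → n ≤ d ℕ.+ suc (toℕ t ℕ.+ m)
    n≤ t = ℕ.≤-trans n≤1+d+m (ℕ.≤-trans (s≤s (ℕ.+-monoʳ-≤ d (ℕ.m≤n+m m (toℕ t))))
                                        (ℕ.≤-reflexive (sym (ℕ.+-suc d (toℕ t ℕ.+ m)))))

-- Graphs

sumℕ≡sum : ∀ {n} (f : Fin n → ℕ) → sumℕ f ≡ ℕΣ.sum f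
sumℕ≡sum {zero}  f = refl
sumℕ≡sum {suc n} f = cong (ℕ._+_ (f zero)) (sumℕ≡sum (f ∘ suc))

pos-sumℕ : ∀ {n} (f : Fin n → ℕ) → + sumℕ f ≡ sumℤ (λ i → + f i)
pos-sumℕ {zero}  f = refl
pos-sumℕ {suc n} f = trans (ℤ.pos-+ (f zero) _) (cong (_+_ (+ f zero)) (pos-sumℕ (f ∘ suc)))

toℤ : ∀ {n} → Matrix ℕ n → Matrix ℤ n
toℤ M i j = + M i j

toℤ-matPow : ∀ {n} (M : Matrix ℕ n) s i j → + matPow M s i j ≡ (toℤ M ^ᴹ s) i j
toℤ-matPow M zero    i j = refl
toℤ-matPow M (suc s) i j = trans (pos-sumℕ (λ k → M i k ℕ.* matPow M s k j))
  (sumℤ-cong λ k → trans (ℤ.pos-* (M i k) (matPow M s k j)) (cong (+ M i k *_) (toℤ-matPow M s k j)))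

trace-toℤ : ∀ {n} (M : Matrix ℕ n) s → trace (toℤ M ^ᴹ s) ≡ + sumℕ (λ i → matPow M s i i)
trace-toℤ M s = sym (trans (pos-sumℕ (λ i → matPow M s i i)) (sumℤ-cong λ i → toℤ-matPow M s i i))

charPoly-eval : ∀ {n} (M : Matrix ℕ n) x → charPoly M x ≡ eval (suc n) (charCoeff (toℤ M)) x
charPoly-eval M = det-eval δ (λ i j → - toℤ M i j)

adjMat-sym : ∀ {n} (G : Graph n) i j → toℤ (adjMat G) i j ≡ toℤ (adjMat G) j i
adjMat-sym G i j = cong (λ b → + b2ℕ b) (Graph.sym G i j)

closed-walks≡⇒cospectral : ∀ {n} (G₁ G₂ : Graph n) →
  (∀ s → sumℕ (λ i → matPow (adjMat G₁) s i i) ≡ sumℕ (λ i → matPow (adjMat G₂) s i i)) → Cospectral G₁ G₂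
closed-walks≡⇒cospectral {n} G₁ G₂ walks≡ x = begin
  charPoly (adjMat G₁) x                   ≡⟨ charPoly-eval (adjMat G₁) x ⟩
  eval (suc n) (charCoeff (toℤ (adjMat G₁))) x
    ≡⟨ eval-cong (suc n) x (traces≡⇒charCoeff≡ _ _ (adjMat-sym G₁) (adjMat-sym G₂) traces≡) ⟩
  eval (suc n) (charCoeff (toℤ (adjMat G₂))) x ≡⟨ charPoly-eval (adjMat G₂) x ⟨
  charPoly (adjMat G₂) x                   ∎
  where
  traces≡ : ∀ s → trace (toℤ (adjMat G₁) ^ᴹ s) ≡ trace (toℤ (adjMat G₂) ^ᴹ s)
  traces≡ s = trans (trace-toℤ (adjMat G₁) s) (trans (cong +_ (walks≡ s)) (sym (trace-toℤ (adjMat G₂) s)))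

≃ᵖ⇒closed-walks≡ : ∀ {n} (G₁ G₂ : Graph n) i i′ → wLabel G₁ i ≃ᵖ wLabel G₂ i′ →
                    ∀ s → matPow (adjMat G₂) s i′ i′ ≡ matPow (adjMat G₁) s i i
≃ᵖ⇒closed-walks≡ G₁ G₂ i i′ (σ , rows≡) s = trans (rows≡ i′ s) (cong (matPow (adjMat G₁) s i) σi′≡i)
  where
  σi′≡i : σ ⟨$⟩ʳ i′ ≡ i
  σi′≡i = sym (idMat≡1⇒≡ (trans (sym (rows≡ i′ zero)) (idMat-diag i′)))

wEquivalent⇒closed-walks≡ : ∀ {n} (G₁ G₂ : Graph n) → wEquivalent G₁ G₂ →
  ∀ s → sumℕ (λ i → matPow (adjMat G₁) s i i) ≡ sumℕ (λ i → matPow (adjMat G₂) s i i)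
wEquivalent⇒closed-walks≡ G₁ G₂ (π , labels≃) s = begin
  sumℕ walks₁                 ≡⟨ sumℕ≡sum walks₁ ⟩
  ℕΣ.sum walks₁               ≡⟨ ℕΣ.sum-cong-≗ (λ i → ≃ᵖ⇒closed-walks≡ G₁ G₂ i (π ⟨$⟩ʳ i) (labels≃ i) s) ⟨
  ℕΣ.sum (walks₂ ∘ (π ⟨$⟩ʳ_)) ≡⟨ ℕΣ.sum-permute walks₂ π ⟨
  ℕΣ.sum walks₂               ≡⟨ sumℕ≡sum walks₂ ⟨
  sumℕ walks₂                 ∎
  where
  walks₁ walks₂ : Fin _ → ℕ
  walks₁ i = matPow (adjMat G₁) s i i
  walks₂ i = matPow (adjMat G₂) s i i

theorem4 : (n : ℕ) → 2 ≤ n → (G₁ G₂ : Graph n) → wEquivalent G₁ G₂ → Cospectral G₁ G₂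
theorem4 n _ G₁ G₂ w-equivalent =
  closed-walks≡⇒cospectral G₁ G₂ (wEquivalent⇒closed-walks≡ G₁ G₂ w-equivalent)
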